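{- Let $u,v\ge 1$ be integers and let $z$ be a positive rational number. Then \[ c_z^{(u,v)}(n,i)\cdot c_z^{(u,v)}(n,2^n+1-i)=1 \quad\text{for all integers } n\ge 0 \text{ and all } i=1,\dots,2^n \] holds if and only if $u=v$ and $z=1$.
   Context: For integers $u,v\ge 1$ and a positive rational $z$, the $(u,v)$-Calkin–Wilf tree $\mathcal{T}^{(u,v)}(z)$ is the infinite binary tree with root $z$ in which every vertex $w$ has left child $w/(uw+1)$ and right child $w+v$. Rows are numbered from $0$ (row $0$ is the root), so row $n$ has $2^n$ vertices; $c_z^{(u,v)}(n,i)$ denotes the $i$-th vertex from the left in row $n$ (the left and right children of the $k$-th vertex of row $n$ are the $(2k-1)$-th and $2k$-th vertices of row $n+1$). -}

module Defs where

open import Data.Nat as ℕ using (ℕ; zero; suc)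
open import Data.Nat.DivMod using (_/_; _%_)
open import Data.Bool using (if_then_else_)
open import Data.Rational as ℚ using (ℚ; 0ℚ; 1ℚ; _÷_; ≢-nonZero)
open import Data.Integer as ℤ using ()
open import Relation.Nullary using (yes; no)

ℕ→ℚ : ℕ → ℚ
ℕ→ℚ n = (ℤ.+ n) ℚ./ 1

-- The denominator u w + 1 is positive for the
-- positive rationals occurring in the tree; the value 0ℚ in the (never used)
-- case u w + 1 = 0 only serves to make the function total.
leftChild : ℕ → ℚ → ℚ
leftChild u w with (ℕ→ℚ u ℚ.* w ℚ.+ 1ℚ) ℚ.≟ 0ℚ
... | yes _ = 0ℚ
... | no d≢0 = _÷_ w (ℕ→ℚ u ℚ.* w ℚ.+ 1ℚ) {{≢-nonZero d≢0}}

rightChild : ℕ → ℚ → ℚ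
rightChild v w = w ℚ.+ ℕ→ℚ v

-- cw u v z n i = c_z^{(u,v)}(n,i), the i-th vertex (1-based, 1 ≤ i ≤ 2^n)
-- from the left in row n of the (u,v)-Calkin–Wilf tree with root z.
-- Vertex i of row n+1 is the left child (i odd) of vertex (i+1)/2 of row n,
-- or the right child (i even) of vertex i/2 of row n.
-- (Values at indices outside 1..2^n are irrelevant junk.)
cw : ℕ → ℕ → ℚ → ℕ → ℕ → ℚ
cw u v z zero    i = z
cw u v z (suc n) i =
  if (i % 2) ℕ.≡ᵇ 0
  then rightChild v (cw u v z n (i / 2))
  else leftChild u (cw u v z n (suc i / 2))

-- If w·w' = 1 then (w / (u w + 1)) · (w' + v) = (v w + 1) / (u w + 1), which is 1
-- exactly when u = v.  The vertex 2k of row n+1 is the right child of vertex k and the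
-- mirror vertex 2m+1 the left child of vertex m+1, and k, m+1 are mirror positions of
-- row n; so for u = v the reciprocity of mirror vertices passes from each row to the
-- next, and it holds in row 0 iff z·z = 1, i.e. z = 1.  Conversely, row 1 says that
-- (z / (u z + 1)) · (z + v) = 1 with z·z = 1, forcing u = v.
module Submission where

open import Defs
open import Data.Nat as ℕ using (ℕ; zero; suc; _^_; _∸_; _≤_; _+_; _*_)
import Data.Nat.Properties as ℕₚ
open import Data.Nat.DivMod using (_/_; _%_; m*n%n≡0; m*n/n≡m; [m+kn]%n≡m%n)
import Data.Nat.Coprimality as Coprimality
open import Data.Rational as ℚ using (ℚ; 0ℚ; 1ℚ; Positive; NonNegative; NonZero; 1/_; _÷_)
open import Data.Rational.Properties
open import Data.Integer as ℤ using ()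
import Data.Integer.Properties as ℤₚ
import Algebra.Properties.Group +-0-group as +-Group
open import Algebra.Properties.Quasigroup +-Group.quasigroup using () renaming (cancelʳ to +-cancelʳ)
open import Data.Bool using (true; false)
open import Data.Product using (_×_; _,_)
open import Function.Bundles using (_⇔_; mk⇔)
open import Relation.Nullary using (yes; no; contradiction)
open import Relation.Binary.Definitions using (tri<; tri≈; tri>)
open import Relation.Binary.PropositionalEquality
open ≡-Reasoning

ℕ→ℚ-nonNeg : ∀ n → NonNegative (ℕ→ℚ n)
ℕ→ℚ-nonNeg n = normalize-nonNeg n 1

ℕ→ℚ-injective : ∀ {m n} → ℕ→ℚ m ≡ ℕ→ℚ n → m ≡ n
ℕ→ℚ-injective {m} {n} eq = ℤₚ.+-injective (begin
  ℤ.+ m                    ≡⟨ numerator-ℕ→ℚ m ⟨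
  ℚ.numerator (ℕ→ℚ m)      ≡⟨ cong ℚ.numerator eq ⟩
  ℚ.numerator (ℕ→ℚ n)      ≡⟨ numerator-ℕ→ℚ n ⟩
  ℤ.+ n                    ∎)
  where
  numerator-ℕ→ℚ : ∀ k → ℚ.numerator (ℕ→ℚ k) ≡ ℤ.+ k
  numerator-ℕ→ℚ k = cong ℚ.numerator (normalize-coprime (Coprimality.sym (Coprimality.1-coprimeTo k)))

*-cancelʳ-≡ : ∀ p q r .{{_ : NonZero r}} → p ℚ.* r ≡ q ℚ.* r → p ≡ q
*-cancelʳ-≡ p q r eq = begin
  p                        ≡⟨ *-identityʳ p ⟨
  p ℚ.* 1ℚ                 ≡⟨ cong (p ℚ.*_) (*-inverseʳ r) ⟨
  p ℚ.* (r ℚ.* 1/ r)       ≡⟨ *-assoc p r (1/ r) ⟨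
  p ℚ.* r ℚ.* 1/ r         ≡⟨ cong (ℚ._* 1/ r) eq ⟩
  q ℚ.* r ℚ.* 1/ r         ≡⟨ *-assoc q r (1/ r) ⟩
  q ℚ.* (r ℚ.* 1/ r)       ≡⟨ cong (q ℚ.*_) (*-inverseʳ r) ⟩
  q ℚ.* 1ℚ                 ≡⟨ *-identityʳ q ⟩
  q                        ∎

leftDenominator : ℕ → ℚ → ℚ
leftDenominator u w = ℕ→ℚ u ℚ.* w ℚ.+ 1ℚ

leftDenominator-pos : ∀ u w {{_ : Positive w}} → Positive (leftDenominator u w)
leftDenominator-pos u w =
  nonNeg+pos⇒pos (ℕ→ℚ u ℚ.* w) {{nonNeg*nonNeg⇒nonNeg (ℕ→ℚ u) {{ℕ→ℚ-nonNeg u}} w {{pos⇒nonNeg w}}}} 1ℚ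

leftDenominator-nonZero : ∀ u w {{_ : Positive w}} → NonZero (leftDenominator u w)
leftDenominator-nonZero u w = pos⇒nonZero (leftDenominator u w) {{leftDenominator-pos u w}}

leftChild≡÷ : ∀ u w {{_ : Positive w}} →
  leftChild u w ≡ (w ÷ leftDenominator u w) {{leftDenominator-nonZero u w}}
leftChild≡÷ u w with leftDenominator u w ℚ.≟ 0ℚ
... | yes d≡0 = contradiction (sym d≡0) (<⇒≢ (positive⁻¹ (leftDenominator u w) {{leftDenominator-pos u w}}))
... | no _ = refl

leftChild-*-leftDenominator : ∀ u w {{_ : Positive w}} → leftChild u w ℚ.* leftDenominator u w ≡ w
leftChild-*-leftDenominator u w = begin
  leftChild u w ℚ.* d              ≡⟨ cong (ℚ._* d) (leftChild≡÷ u w) ⟩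
  w ℚ.* 1/ d ℚ.* d                 ≡⟨ *-assoc w (1/ d) d ⟩
  w ℚ.* (1/ d ℚ.* d)               ≡⟨ cong (w ℚ.*_) (*-inverseˡ d) ⟩
  w ℚ.* 1ℚ                         ≡⟨ *-identityʳ w ⟩
  w                                ∎
  where
  d : ℚ
  d = leftDenominator u w
  instance
    d≢0 : NonZero d
    d≢0 = leftDenominator-nonZero u w

leftChild-pos : ∀ u w {{_ : Positive w}} → Positive (leftChild u w)
leftChild-pos u w = subst Positive (sym (leftChild≡÷ u w))
  (pos*pos⇒pos w (1/ d) {{1/pos⇒pos d {{leftDenominator-pos u w}}}})
  where
  d : ℚ
  d = leftDenominator u w
  instance
    d≢0 : NonZero d
    d≢0 = leftDenominator-nonZero u w

rightChild-pos : ∀ v w {{_ : Positive w}} → Positive (rightChild v w)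
rightChild-pos v w = pos+nonNeg⇒pos w (ℕ→ℚ v) {{ℕ→ℚ-nonNeg v}}

leftChild-*-rightChild : ∀ u v w w' {{_ : Positive w}} → w ℚ.* w' ≡ 1ℚ →
  leftChild u w ℚ.* rightChild v w' ℚ.* leftDenominator u w ≡ leftDenominator v w
leftChild-*-rightChild u v w w' ww'≡1 = begin
  l ℚ.* (w' ℚ.+ V) ℚ.* leftDenominator u w    ≡⟨ *-assoc l (w' ℚ.+ V) _ ⟩
  l ℚ.* ((w' ℚ.+ V) ℚ.* leftDenominator u w)  ≡⟨ cong (l ℚ.*_) (*-comm (w' ℚ.+ V) _) ⟩
  l ℚ.* (leftDenominator u w ℚ.* (w' ℚ.+ V))  ≡⟨ *-assoc l _ (w' ℚ.+ V) ⟨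
  l ℚ.* leftDenominator u w ℚ.* (w' ℚ.+ V)    ≡⟨ cong (ℚ._* (w' ℚ.+ V)) (leftChild-*-leftDenominator u w) ⟩
  w ℚ.* (w' ℚ.+ V)                            ≡⟨ *-distribˡ-+ w w' V ⟩
  w ℚ.* w' ℚ.+ w ℚ.* V                        ≡⟨ cong₂ ℚ._+_ ww'≡1 (*-comm w V) ⟩
  1ℚ ℚ.+ V ℚ.* w                              ≡⟨ +-comm 1ℚ (V ℚ.* w) ⟩
  V ℚ.* w ℚ.+ 1ℚ                              ∎
  where
  l V : ℚ
  l = leftChild u w
  V = ℕ→ℚ v

leftChild-*-rightChild≡1 : ∀ u w w' {{_ : Positive w}} → w ℚ.* w' ≡ 1ℚ →
  leftChild u w ℚ.* rightChild u w' ≡ 1ℚ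
leftChild-*-rightChild≡1 u w w' ww'≡1 =
  *-cancelʳ-≡ _ 1ℚ (leftDenominator u w) {{leftDenominator-nonZero u w}}
    (trans (leftChild-*-rightChild u u w w' ww'≡1) (sym (*-identityˡ _)))

leftChild-*-rightChild≡1⇒≡ : ∀ u v w w' {{_ : Positive w}} → w ℚ.* w' ≡ 1ℚ →
  leftChild u w ℚ.* rightChild v w' ≡ 1ℚ → u ≡ v
leftChild-*-rightChild≡1⇒≡ u v w w' ww'≡1 lr≡1 =
  ℕ→ℚ-injective (*-cancelʳ-≡ (ℕ→ℚ u) (ℕ→ℚ v) w {{pos⇒nonZero w}}
    (+-cancelʳ 1ℚ (ℕ→ℚ u ℚ.* w) (ℕ→ℚ v ℚ.* w) (begin
      leftDenominator u w                                    ≡⟨ *-identityˡ _ ⟨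
      1ℚ ℚ.* leftDenominator u w                             ≡⟨ cong (ℚ._* leftDenominator u w) lr≡1 ⟨
      leftChild u w ℚ.* rightChild v w' ℚ.* leftDenominator u w ≡⟨ leftChild-*-rightChild u v w w' ww'≡1 ⟩
      leftDenominator v w                                    ∎)))

pos∧p*p≡1⇒p≡1 : ∀ p {{_ : Positive p}} → p ℚ.* p ≡ 1ℚ → p ≡ 1ℚ
pos∧p*p≡1⇒p≡1 p pp≡1 with <-cmp p 1ℚ
... | tri≈ _ p≡1 _ = p≡1
... | tri< p<1 _ _ = contradiction (subst₂ ℚ._<_ pp≡1 (*-identityˡ p) (*-monoˡ-<-pos p p<1)) (<-asym p<1)
... | tri> _ _ p>1 = contradiction (subst₂ ℚ._<_ (*-identityˡ p) pp≡1 (*-monoˡ-<-pos p p>1)) (<-asym p>1)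

data ParityView : ℕ → Set where
  even : ∀ k → ParityView (k * 2)
  odd  : ∀ k → ParityView (suc (k * 2))

parityView : ∀ n → ParityView n
parityView zero = even 0
parityView (suc n) with parityView n
... | even k = odd k
... | odd k  = even (suc k)

module _ (u v : ℕ) (z : ℚ) where

  cw-pos : {{_ : Positive z}} → ∀ n i → Positive (cw u v z n i)
  cw-pos {{z>0}} zero i = z>0
  cw-pos (suc n) i with (i % 2) ℕ.≡ᵇ 0
  ... | true  = rightChild-pos v (cw u v z n (i / 2)) {{cw-pos n (i / 2)}}
  ... | false = leftChild-pos u (cw u v z n (suc i / 2)) {{cw-pos n (suc i / 2)}}

  cw-even : ∀ n k → cw u v z (suc n) (k * 2) ≡ rightChild v (cw u v z n k)
  cw-even n k rewrite m*n%n≡0 k 2 {{_}} | m*n/n≡m k 2 {{_}} = refl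

  cw-odd : ∀ n k → cw u v z (suc n) (suc (k * 2)) ≡ leftChild u (cw u v z n (suc k))
  cw-odd n k rewrite [m+kn]%n≡m%n 1 k 2 {{_}} | m*n/n≡m (suc k) 2 {{_}} = refl

k*2+m*2≡2*[k+m] : ∀ k m → k * 2 + m * 2 ≡ 2 * (k + m)
k*2+m*2≡2*[k+m] k m = trans (sym (ℕₚ.*-distribʳ-+ 2 k m)) (ℕₚ.*-comm (k + m) 2)

k*2+[1+m*2]≡1+2*[k+m] : ∀ k m → k * 2 + suc (m * 2) ≡ suc (2 * (k + m))
k*2+[1+m*2]≡1+2*[k+m] k m = trans (ℕₚ.+-suc (k * 2) (m * 2)) (cong suc (k*2+m*2≡2*[k+m] k m))

even+even≢odd : ∀ k m n → k * 2 + m * 2 ≢ suc (2 * n)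
even+even≢odd k m n eq = ℕₚ.even≢odd (k + m) n (trans (sym (k*2+m*2≡2*[k+m] k m)) eq)

odd+odd≢odd : ∀ k m n → suc (k * 2) + suc (m * 2) ≢ suc (2 * n)
odd+odd≢odd k m n eq =
  ℕₚ.even≢odd n (k + m) (trans (sym (ℕₚ.suc-injective eq)) (k*2+[1+m*2]≡1+2*[k+m] k m))

even+odd≡odd⇒ : ∀ k m n → k * 2 + suc (m * 2) ≡ suc (2 * n) → k + m ≡ n
even+odd≡odd⇒ k m n eq =
  ℕₚ.*-cancelˡ-≡ (k + m) n 2 (ℕₚ.suc-injective (trans (sym (k*2+[1+m*2]≡1+2*[k+m] k m)) eq))

-- All index pairs count, out-of-range ones included.
ReciprocalRow : ℕ → ℕ → ℚ → ℕ → Set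
ReciprocalRow u v z n = ∀ a b → a + b ≡ suc (2 ^ n) → cw u v z n a ℚ.* cw u v z n b ≡ 1ℚ

reciprocalRow⇒even*odd≡1 : ∀ u z {{_ : Positive z}} n → ReciprocalRow u u z n →
  ∀ k m → k + m ≡ 2 ^ n → cw u u z (suc n) (k * 2) ℚ.* cw u u z (suc n) (suc (m * 2)) ≡ 1ℚ
reciprocalRow⇒even*odd≡1 u z n row k m k+m≡2^n = begin
  cw u u z (suc n) (k * 2) ℚ.* cw u u z (suc n) (suc (m * 2))
    ≡⟨ cong₂ ℚ._*_ (cw-even u u z n k) (cw-odd u u z n m) ⟩
  rightChild u (cw u u z n k) ℚ.* leftChild u (cw u u z n (suc m))
    ≡⟨ *-comm (rightChild u (cw u u z n k)) _ ⟩
  leftChild u (cw u u z n (suc m)) ℚ.* rightChild u (cw u u z n k)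
    ≡⟨ leftChild-*-rightChild≡1 u _ _ {{cw-pos u u z n (suc m)}} (row (suc m) k suc-m+k≡suc-2^n) ⟩
  1ℚ ∎
  where
  suc-m+k≡suc-2^n : suc m + k ≡ suc (2 ^ n)
  suc-m+k≡suc-2^n = cong suc (trans (ℕₚ.+-comm m k) k+m≡2^n)

reciprocalRow-suc : ∀ u z {{_ : Positive z}} n → ReciprocalRow u u z n → ReciprocalRow u u z (suc n)
reciprocalRow-suc u z n row a b a+b≡ with parityView a | parityView b
... | even k | even m = contradiction a+b≡ (even+even≢odd k m (2 ^ n))
... | odd k  | odd m  = contradiction a+b≡ (odd+odd≢odd k m (2 ^ n))
... | even k | odd m  = reciprocalRow⇒even*odd≡1 u z n row k m (even+odd≡odd⇒ k m (2 ^ n) a+b≡)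
... | odd k  | even m = trans (*-comm (cw u u z (suc n) (suc (k * 2))) _)
  (reciprocalRow⇒even*odd≡1 u z n row m k (even+odd≡odd⇒ m k (2 ^ n) (trans (ℕₚ.+-comm (m * 2) _) a+b≡)))

reciprocalRow-1 : ∀ u n → ReciprocalRow u u 1ℚ n
reciprocalRow-1 u zero    _ _ _ = refl
reciprocalRow-1 u (suc n) = reciprocalRow-suc u 1ℚ n (reciprocalRow-1 u n)

corollary4p3 : (u v : ℕ) → 1 ≤ u → 1 ≤ v → (z : ℚ) → Positive z →
    ((n i : ℕ) → 1 ≤ i → i ≤ 2 ^ n →
      cw u v z n i ℚ.* cw u v z n ((2 ^ n + 1) ∸ i) ≡ 1ℚ)
    ⇔ (u ≡ v × z ≡ 1ℚ)
corollary4p3 u v _ _ z z>0 = mk⇔ reciprocal⇒ ⇒reciprocal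
  where
  instance
    z-pos : Positive z
    z-pos = z>0
  reciprocal⇒ : ((n i : ℕ) → 1 ≤ i → i ≤ 2 ^ n →
      cw u v z n i ℚ.* cw u v z n ((2 ^ n + 1) ∸ i) ≡ 1ℚ) → u ≡ v × z ≡ 1ℚ
  reciprocal⇒ rows = leftChild-*-rightChild≡1⇒≡ u v z z z*z≡1 (rows 1 1 ℕₚ.≤-refl (ℕₚ.m≤m+n 1 1))
                   , pos∧p*p≡1⇒p≡1 z z*z≡1
    where
    z*z≡1 : z ℚ.* z ≡ 1ℚ
    z*z≡1 = rows 0 1 ℕₚ.≤-refl ℕₚ.≤-refl
  ⇒reciprocal : u ≡ v × z ≡ 1ℚ → (n i : ℕ) → 1 ≤ i → i ≤ 2 ^ n →
      cw u v z n i ℚ.* cw u v z n ((2 ^ n + 1) ∸ i) ≡ 1ℚ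
  ⇒reciprocal (refl , refl) n i _ i≤2^n = reciprocalRow-1 u n i _
    (trans (ℕₚ.m+[n∸m]≡n (ℕₚ.m≤n⇒m≤n+o 1 i≤2^n)) (ℕₚ.+-comm (2 ^ n) 1))
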